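{- Let $a,b,c\in\mathbb{N}$ with $a\le b\le c$, $3a<b+c$ and $2b\le c$. Then $f(a,b,c)=c-1$.
   Context: $\mathbb{N}$ denotes the positive integers and $[n]=\{1,\dots,n\}$. For $a,b,c\in\mathbb{N}$, $f(a,b,c)$ denotes the metric dimension of the Cartesian product $K_a\times K_b\times K_c$ of complete graphs (vertex set $[a]\times[b]\times[c]$, two triples adjacent iff they differ in exactly one coordinate); the metric dimension of a graph is the minimum size of a vertex set $U$ such that every vertex is uniquely determined by its vector of distances to the vertices of $U$. Equivalently, $f(a,b,c)$ is the minimum cardinality of a set $Q\subseteq[a]\times[b]\times[c]$ such that for all distinct $s,s'$ there is $q\in Q$ with $g(s,q)\neq g(s',q)$, where $g(s,q)$ is the number of indices $i\in[3]$ with $s_i=q_i$. -}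

module Defs where

open import Data.Nat using (ℕ; zero; suc; _+_; _≤_)
open import Data.Fin using (Fin)
open import Data.Product using (_×_; _,_; Σ; ∃-syntax)
open import Data.List using (List; length)
open import Data.List.Membership.Propositional using (_∈_)
open import Data.List.Relation.Unary.Unique.Propositional using (Unique)
open import Relation.Binary.PropositionalEquality using (_≡_; _≢_)
open import Relation.Nullary using (Dec; yes; no)
open import Data.Fin using (_≟_)

-- Vertices of K_a × K_b × K_c : triples in [a] × [b] × [c] (Fin n models [n]).
Vertex : ℕ → ℕ → ℕ → Set
Vertex a b c = Fin a × Fin b × Fin c

eqInd : ∀ {n} → Fin n → Fin n → ℕ
eqInd x y with x ≟ y
... | yes _ = 1
... | no _ = 0

g : ∀ {a b c} → Vertex a b c → Vertex a b c → ℕ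
g (s₁ , s₂ , s₃) (q₁ , q₂ , q₃) = eqInd s₁ q₁ + eqInd s₂ q₂ + eqInd s₃ q₃

Resolving : ∀ {a b c} → List (Vertex a b c) → Set
Resolving {a} {b} {c} Q =
  (s s' : Vertex a b c) → s ≢ s' → ∃[ q ] (q ∈ Q × g s q ≢ g s' q)

-- k is the metric dimension f(a,b,c): the minimum cardinality of a resolving set.
-- Sets are represented as duplicate-free lists, cardinality = length.
IsMetricDim : ℕ → ℕ → ℕ → ℕ → Set
IsMetricDim a b c k =
  (∃[ Q ] (Unique Q × Resolving {a} {b} {c} Q × length Q ≡ k))
  × ((Q : List (Vertex a b c)) → Unique Q → Resolving Q → k ≤ length Q)

{-# OPTIONS --safe #-}
-- Lower bound: if |Q| < c - 1 then two values z ≠ z′ occur as third coordinate of no q ∈ Q, and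
-- (x, y, z), (x, y, z′) have the same distance profile.
-- Upper bound, for c = n + 1: the n points (k mod a, ⌊k/2⌋ mod b, k), k < n, resolve.  Since 2a < c
-- (which follows from 3a < b + c and 2b ≤ c), every x < a is the first coordinate of the points k = x
-- and k = x + a, which have different second coordinates; since 2b ≤ c, every y < b - 1 is the second
-- coordinate of the points k = 2y and k = 2y + 1, whose first coordinates differ when a ≥ 2.  Comparing
-- the numbers of coordinates in which two vertices agree with these points recovers first the first,
-- then the second and finally the third coordinate.
module Submission where

open import Defs
open import Data.Nat using (ℕ; zero; suc; _+_; _*_; _∸_; _≤_; _<_; z≤n; s≤s; s≤s⁻¹; z<s; NonZero; ⌊_/2⌋)
import Data.Nat as ℕ
open import Data.Nat.Properties hiding (_≟_)
open import Data.Nat.DivMod using (_%_; _mod_; m<n⇒m%n≡m; [m+n]%n≡m%n; %-pred-≡0; [1+m%d]≤1+n⇒[m%d]≤n)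
open import Data.Fin using (Fin; toℕ; fromℕ; fromℕ<; inject₁; _≟_)
open import Data.Fin.Properties
  using (toℕ<n; toℕ-injective; toℕ-fromℕ<; toℕ-inject₁; inject₁-injective; fromℕ≢inject₁; injective⇒≤; ¬∀⟶∃¬)
open import Data.Product using (∃; ∃₂; _×_; _,_)
open import Data.Sum using (_⊎_; inj₁; inj₂; [_,_])
open import Function using (_∘_; flip)
open import Data.List using (List; length; lookup; tabulate)
open import Data.List.Properties using (length-tabulate)
open import Data.List.Relation.Unary.Any using (Any; index; any?)
open import Data.List.Relation.Unary.Any.Properties using (lookup-index)
open import Data.List.Membership.Propositional using (lose)
open import Data.List.Membership.Propositional.Properties using (∈-tabulate⁺)
open import Data.List.Relation.Unary.Unique.Propositional using (Unique)
open import Data.List.Relation.Unary.Unique.Propositional.Properties using (tabulate⁺)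
open import Relation.Binary.PropositionalEquality
  using (_≡_; _≢_; refl; sym; trans; cong; subst; module ≡-Reasoning)
open import Relation.Nullary using (¬_; Dec; yes; no; contradiction)
open import Relation.Nullary.Decidable using (decidable-stable)

module _ {m : ℕ} {x y : Fin m} where

  ≡⇒eqInd≡1 : x ≡ y → eqInd x y ≡ 1
  ≡⇒eqInd≡1 x≡y with x ≟ y
  ... | yes _   = refl
  ... | no x≢y = contradiction x≡y x≢y

  ≢⇒eqInd≡0 : x ≢ y → eqInd x y ≡ 0
  ≢⇒eqInd≡0 x≢y with x ≟ y
  ... | yes x≡y = contradiction x≡y x≢y
  ... | no _    = refl

  eqInd≢0⇒≡ : eqInd x y ≢ 0 → x ≡ y
  eqInd≢0⇒≡ eqInd≢0 with x ≟ y
  ... | yes x≡y = x≡y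
  ... | no _    = contradiction refl eqInd≢0

module _ {a b c : ℕ} {s₁ t₁ q₁ : Fin a} {s₂ t₂ q₂ : Fin b} {s₃ t₃ q₃ : Fin c}
         (E : g (s₁ , s₂ , s₃) (q₁ , q₂ , q₃) ≡ g (t₁ , t₂ , t₃) (q₁ , q₂ , q₃)) where

  s₁≡q₁∧t₁≢q₁∧t₃≢q₃⇒t₂≡q₂ : s₁ ≡ q₁ → t₁ ≢ q₁ → t₃ ≢ q₃ → t₂ ≡ q₂
  s₁≡q₁∧t₁≢q₁∧t₃≢q₃⇒t₂≡q₂ s₁≡q₁ t₁≢q₁ t₃≢q₃ =
    eqInd≢0⇒≡ (count (≡⇒eqInd≡1 s₁≡q₁) (≢⇒eqInd≡0 t₁≢q₁) (≢⇒eqInd≡0 t₃≢q₃) E)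
    where
    count : ∀ {u v w u′ v′ w′} → u ≡ 1 → u′ ≡ 0 → w′ ≡ 0 → u + v + w ≡ u′ + v′ + w′ → v′ ≢ 0
    count refl refl refl () refl

  s₁≡q₁∧t₁≢q₁∧t₃≢q₃⇒s₂≢t₂ : s₁ ≡ q₁ → t₁ ≢ q₁ → t₃ ≢ q₃ → s₂ ≢ t₂
  s₁≡q₁∧t₁≢q₁∧t₃≢q₃⇒s₂≢t₂ s₁≡q₁ t₁≢q₁ t₃≢q₃ s₂≡t₂ =
    count (≡⇒eqInd≡1 s₁≡q₁) (≡⇒eqInd≡1 (trans s₂≡t₂ t₂≡q₂)) (≢⇒eqInd≡0 t₁≢q₁)
          (≡⇒eqInd≡1 t₂≡q₂) (≢⇒eqInd≡0 t₃≢q₃) E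
    where
    t₂≡q₂ : t₂ ≡ q₂
    t₂≡q₂ = s₁≡q₁∧t₁≢q₁∧t₃≢q₃⇒t₂≡q₂ s₁≡q₁ t₁≢q₁ t₃≢q₃

    count : ∀ {u v w u′ v′ w′} → u ≡ 1 → v ≡ 1 → u′ ≡ 0 → v′ ≡ 1 → w′ ≡ 0 →
            u + v + w ≢ u′ + v′ + w′
    count refl refl refl refl refl ()

  s₂≢q₂∧s₃≡q₃∧t₁≡q₁∧t₂≡q₂⇒s₁≡q₁ : s₂ ≢ q₂ → s₃ ≡ q₃ → t₁ ≡ q₁ → t₂ ≡ q₂ → s₁ ≡ q₁
  s₂≢q₂∧s₃≡q₃∧t₁≡q₁∧t₂≡q₂⇒s₁≡q₁ s₂≢q₂ s₃≡q₃ t₁≡q₁ t₂≡q₂ =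
    eqInd≢0⇒≡ (count (≢⇒eqInd≡0 s₂≢q₂) (≡⇒eqInd≡1 s₃≡q₃) (≡⇒eqInd≡1 t₁≡q₁) (≡⇒eqInd≡1 t₂≡q₂) E)
    where
    count : ∀ {u v w u′ v′ w′} → v ≡ 0 → w ≡ 1 → u′ ≡ 1 → v′ ≡ 1 →
            u + v + w ≡ u′ + v′ + w′ → u ≢ 0
    count refl refl refl refl () refl

  s₂≢q₂∧s₃≢q₃∧t₂≡q₂⇒s₁≡q₁ : s₂ ≢ q₂ → s₃ ≢ q₃ → t₂ ≡ q₂ → s₁ ≡ q₁
  s₂≢q₂∧s₃≢q₃∧t₂≡q₂⇒s₁≡q₁ s₂≢q₂ s₃≢q₃ t₂≡q₂ =
    eqInd≢0⇒≡ (count {u′ = eqInd t₁ q₁} {w′ = eqInd t₃ q₃}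
                     (≢⇒eqInd≡0 s₂≢q₂) (≢⇒eqInd≡0 s₃≢q₃) (≡⇒eqInd≡1 t₂≡q₂) E)
    where
    count : ∀ {u v w u′ v′ w′} → v ≡ 0 → w ≡ 0 → v′ ≡ 1 → u + v + w ≡ u′ + v′ + w′ → u ≢ 0
    count {u′ = u′} refl refl refl eq refl = m+1+n≢0 u′ (m+n≡0⇒m≡0 (u′ + 1) (sym eq))

module _ {a b c : ℕ} {x q₁ : Fin a} {s₂ t₂ q₂ : Fin b} {s₃ t₃ q₃ : Fin c} where

  s₂≡q₂∧t₂≢q₂⇒t₃≡q₃ : g (x , s₂ , s₃) (q₁ , q₂ , q₃) ≡ g (x , t₂ , t₃) (q₁ , q₂ , q₃) →
                      s₂ ≡ q₂ → t₂ ≢ q₂ → t₃ ≡ q₃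
  s₂≡q₂∧t₂≢q₂⇒t₃≡q₃ E s₂≡q₂ t₂≢q₂ = eqInd≢0⇒≡ (count (≡⇒eqInd≡1 s₂≡q₂) (≢⇒eqInd≡0 t₂≢q₂) E)
    where
    count : ∀ {u v w v′ w′} → v ≡ 1 → v′ ≡ 0 → u + v + w ≡ u + v′ + w′ → w′ ≢ 0
    count {zero}  refl refl () refl
    count {suc u} refl refl eq refl = count {u} refl refl (suc-injective eq) refl

  s₃≡q₃⇒t₃≡q₃ : s₂ ≡ t₂ → g (x , s₂ , s₃) (q₁ , q₂ , q₃) ≡ g (x , t₂ , t₃) (q₁ , q₂ , q₃) →
                s₃ ≡ q₃ → t₃ ≡ q₃
  s₃≡q₃⇒t₃≡q₃ refl E s₃≡q₃ =
    eqInd≢0⇒≡ λ eqInd≡0 → 1+n≢0 (trans (sym (≡⇒eqInd≡1 s₃≡q₃)) (trans (+-cancelˡ-≡ _ _ _ E) eqInd≡0))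

suc[m]%d≢m%d : ∀ m {d} .{{_ : NonZero d}} → 2 ≤ d → suc m % d ≢ m % d
suc[m]%d≢m%d m {d} 2≤d with suc m % d in eq
... | zero  = λ 0≡m%d → contradiction (trans 0≡m%d (%-pred-≡0 eq)) (d∸1≢0 2≤d)
  where
  d∸1≢0 : 2 ≤ d → 0 ≢ d ∸ 1
  d∸1≢0 (s≤s (s≤s _)) ()
... | suc r = λ 1+r≡m%d →
  1+n≰n (subst (_≤ r) (sym 1+r≡m%d)
                ([1+m%d]≤1+n⇒[m%d]≤n m r d (subst (0 <_) (sym eq) z<s) (≤-reflexive eq)))

⌊m/2⌋<n : ∀ {m n} → m < n + n → ⌊ m /2⌋ < n
⌊m/2⌋<n {n = n} m<n+n = subst (_ ≤_) (sym (n≡⌈n+n/2⌉ n)) (⌊n/2⌋-mono (s≤s m<n+n))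

⌊m/2⌋<⌊m+n/2⌋ : ∀ m {n} → 2 ≤ n → ⌊ m /2⌋ < ⌊ m + n /2⌋
⌊m/2⌋<⌊m+n/2⌋ m {n} 2≤n = ⌊n/2⌋-mono (subst (_≤ m + n) (+-comm m 2) (+-monoʳ-≤ m 2≤n))

2*m≡m+m : ∀ m → 2 * m ≡ m + m
2*m≡m+m m = cong (m +_) (+-identityʳ m)

2*a<c : ∀ a b {c} → 3 * a < b + c → 2 * b ≤ c → 2 * a < c
2*a<c a b 3a<b+c 2b≤c =
  ≰⇒> λ c≤2a → <⇒≱ 3a<b+c (+-mono-≤ {b} {a} (*-cancelˡ-≤ 2 (≤-trans 2b≤c c≤2a)) c≤2a)

≢⇒2≤ : ∀ {m} {x y : Fin m} → x ≢ y → 2 ≤ m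
≢⇒2≤ {x = Fin.zero}  {Fin.zero}  x≢y = contradiction refl x≢y
≢⇒2≤ {x = Fin.zero}  {Fin.suc j} _   = ≤-trans (s≤s (s≤s z≤n)) (toℕ<n (Fin.suc j))
≢⇒2≤ {x = Fin.suc i}             _   = ≤-trans (s≤s (s≤s z≤n)) (toℕ<n (Fin.suc i))

fromℕ⊎inject₁ : ∀ {m} (z : Fin (suc m)) → z ≡ fromℕ m ⊎ ∃ λ k → z ≡ inject₁ k
fromℕ⊎inject₁ {zero}  Fin.zero    = inj₁ refl
fromℕ⊎inject₁ {suc m} Fin.zero    = inj₂ (Fin.zero , refl)
fromℕ⊎inject₁ {suc m} (Fin.suc z) with fromℕ⊎inject₁ z
... | inj₁ z≡last    = inj₁ (cong Fin.suc z≡last)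
... | inj₂ (k , z≡k) = inj₂ (Fin.suc k , cong Fin.suc z≡k)

one-of-distinct : ∀ {m} {P : Fin (suc m) → Set} → (∀ k → P (inject₁ k)) →
                  ∀ {y y′} → y ≢ y′ → P y ⊎ P y′
one-of-distinct {P = P} P-inject₁ {y} {y′} y≢y′ with fromℕ⊎inject₁ y | fromℕ⊎inject₁ y′
... | inj₂ (k , refl) | _               = inj₁ (P-inject₁ k)
... | inj₁ _          | inj₂ (k , refl) = inj₂ (P-inject₁ k)
... | inj₁ refl       | inj₁ refl       = contradiction refl y≢y′

third : ∀ {a b c} → Vertex a b c → Fin c
third (_ , _ , z) = z

module LowerBound {a b c : ℕ} (Q : List (Vertex a b c)) where

  Hit : Fin c → Set
  Hit z = Any (λ q → third q ≡ z) Q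

  label : ∀ {z} → Dec (Hit z) → Fin (suc (length Q))
  label (yes hit) = inject₁ (index hit)
  label (no _)    = fromℕ (length Q)

  module _ (x : Fin a) (y : Fin b) (R : Resolving Q) where
    open ≡-Reasoning

    unhit-unique : ∀ {z z′} → ¬ Hit z → ¬ Hit z′ → z ≡ z′
    unhit-unique {z} {z′} ¬hit ¬hit′ = decidable-stable (z ≟ z′) λ z≢z′ →
      let (q₁ , q₂ , q₃) , q∈Q , g≢ = R (x , y , z) (x , y , z′) (z≢z′ ∘ cong third)
          z≢q₃  = ¬hit ∘ lose q∈Q ∘ sym
          z′≢q₃ = ¬hit′ ∘ lose q∈Q ∘ sym
      in g≢ (cong (eqInd x q₁ + eqInd y q₂ +_) (trans (≢⇒eqInd≡0 z≢q₃) (sym (≢⇒eqInd≡0 z′≢q₃))))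

    label-injective : ∀ {z z′} (d : Dec (Hit z)) (d′ : Dec (Hit z′)) → label d ≡ label d′ → z ≡ z′
    label-injective (yes hit) (yes hit′) eq = begin
      _                                       ≡⟨ lookup-index hit ⟨
      third (lookup Q (index hit))            ≡⟨ cong (third ∘ lookup Q) (inject₁-injective eq) ⟩
      third (lookup Q (index hit′))           ≡⟨ lookup-index hit′ ⟩
      _                                       ∎
    label-injective (yes _)   (no _)     eq = contradiction (sym eq) fromℕ≢inject₁
    label-injective (no _)    (yes _)    eq = contradiction eq fromℕ≢inject₁
    label-injective (no ¬hit) (no ¬hit′) _  = unhit-unique ¬hit ¬hit′

    c∸1≤length : c ∸ 1 ≤ length Q
    c∸1≤length = m≤n+o⇒m∸n≤o c 1 (injective⇒≤ (label-injective (hit? _) (hit? _)))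
      where
      hit? : ∀ z → Dec (Hit z)
      hit? z = any? (λ q → third q ≟ z) Q

module Design {a b n : ℕ} (X : Fin n → Fin a) (Y : Fin n → Fin b) where

  point : Fin n → Vertex a b (suc n)
  point k = X k , Y k , inject₁ k

  points : List (Vertex a b (suc n))
  points = tabulate point

  points-unique : Unique points
  points-unique = tabulate⁺ (inject₁-injective ∘ cong third)

  length-points : length points ≡ n
  length-points = length-tabulate point

  record _≈_ (s t : Vertex a b (suc n)) : Set where
    constructor agree
    field at : ∀ k → g s (point k) ≡ g t (point k)

  open _≈_

  ≈-sym : ∀ {s t} → s ≈ t → t ≈ s
  ≈-sym E = agree (sym ∘ at E)

  XFibreSplit : Fin a → Set
  XFibreSplit x = ∃₂ λ k k′ → X k ≡ x × X k′ ≡ x × Y k ≢ Y k′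

  YFibreSplit : Fin b → Set
  YFibreSplit y = ∃₂ λ k k′ → Y k ≡ y × Y k′ ≡ y × X k ≢ X k′

  YFibreRepeated : Fin b → Set
  YFibreRepeated y = ∃₂ λ k k′ → Y k ≡ y × Y k′ ≡ y × k ≢ k′

  record IsResolving : Set where
    field
      xFibreSplit    : 2 ≤ a → ∀ x → XFibreSplit x
      yFibreSplit    : 2 ≤ a → ∀ {y y′} → y ≢ y′ → YFibreSplit y ⊎ YFibreSplit y′
      yFibreRepeated : ∀ {y y′} → y ≢ y′ → YFibreRepeated y ⊎ YFibreRepeated y′

  module _ {s₁ t₁ : Fin a} {s₂ t₂ : Fin b} {s₃ t₃ : Fin (suc n)}
           (E : (s₁ , s₂ , s₃) ≈ (t₁ , t₂ , t₃)) where

    module _ (s₁≢t₁ : s₁ ≢ t₁) where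

      private
        t₁≢X : ∀ {k} → X k ≡ s₁ → t₁ ≢ X k
        t₁≢X Xk≡s₁ t₁≡Xk = s₁≢t₁ (trans (sym Xk≡s₁) (sym t₁≡Xk))

        t₂≡Y : ∀ {k} → X k ≡ s₁ → t₃ ≢ inject₁ k → t₂ ≡ Y k
        t₂≡Y {k} Xk≡s₁ = s₁≡q₁∧t₁≢q₁∧t₃≢q₃⇒t₂≡q₂ (at E k) (sym Xk≡s₁) (t₁≢X Xk≡s₁)

        pinned : ∀ {k k′} → X k ≡ s₁ → X k′ ≡ s₁ → Y k ≢ Y k′ → t₃ ≡ inject₁ k →
                 (∃ λ k → X k ≡ s₁ × t₃ ≡ inject₁ k) × s₂ ≢ t₂
        pinned {k} {k′} Xk≡s₁ Xk′≡s₁ Yk≢Yk′ t₃≡k =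
          (k , Xk≡s₁ , t₃≡k) , s₁≡q₁∧t₁≢q₁∧t₃≢q₃⇒s₂≢t₂ (at E k′) (sym Xk′≡s₁) (t₁≢X Xk′≡s₁) t₃≢k′
          where
          t₃≢k′ : t₃ ≢ inject₁ k′
          t₃≢k′ t₃≡k′ = Yk≢Yk′ (cong Y (inject₁-injective (trans (sym t₃≡k) t₃≡k′)))

      third-in-XFibre : XFibreSplit s₁ → (∃ λ k → X k ≡ s₁ × t₃ ≡ inject₁ k) × s₂ ≢ t₂
      third-in-XFibre (k₁ , k₂ , Xk₁≡s₁ , Xk₂≡s₁ , Yk₁≢Yk₂) with t₃ ≟ inject₁ k₁ | t₃ ≟ inject₁ k₂
      ... | yes t₃≡k₁ | _         = pinned Xk₁≡s₁ Xk₂≡s₁ Yk₁≢Yk₂ t₃≡k₁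
      ... | no _      | yes t₃≡k₂ = pinned Xk₂≡s₁ Xk₁≡s₁ (Yk₁≢Yk₂ ∘ sym) t₃≡k₂
      ... | no t₃≢k₁  | no t₃≢k₂  =
        contradiction (trans (sym (t₂≡Y Xk₁≡s₁ t₃≢k₁)) (t₂≡Y Xk₂≡s₁ t₃≢k₂)) Yk₁≢Yk₂

    ¬YFibreSplit : ∀ {k} → s₂ ≢ t₂ → X k ≡ t₁ → s₃ ≡ inject₁ k → ¬ YFibreSplit t₂
    ¬YFibreSplit {k} s₂≢t₂ Xk≡t₁ s₃≡k (k₁ , k₂ , Yk₁≡t₂ , Yk₂≡t₂ , Xk₁≢Xk₂) =
      Xk₁≢Xk₂ (trans (X≡s₁ Yk₁≡t₂) (sym (X≡s₁ Yk₂≡t₂)))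
      where
      s₂≢Y : ∀ {k′} → Y k′ ≡ t₂ → s₂ ≢ Y k′
      s₂≢Y Yk′≡t₂ = s₂≢t₂ ∘ flip trans Yk′≡t₂

      X≡s₁ : ∀ {k′} → Y k′ ≡ t₂ → X k′ ≡ s₁
      X≡s₁ {k′} Yk′≡t₂ with s₃ ≟ inject₁ k′
      ... | yes s₃≡k′ =
        sym (s₂≢q₂∧s₃≡q₃∧t₁≡q₁∧t₂≡q₂⇒s₁≡q₁ (at E k′) (s₂≢Y Yk′≡t₂) s₃≡k′ (sym Xk′≡t₁) (sym Yk′≡t₂))
        where
        Xk′≡t₁ : X k′ ≡ t₁
        Xk′≡t₁ = subst (λ j → X j ≡ t₁) (inject₁-injective (trans (sym s₃≡k) s₃≡k′)) Xk≡t₁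
      ... | no s₃≢k′ =
        sym (s₂≢q₂∧s₃≢q₃∧t₂≡q₂⇒s₁≡q₁ {t₁ = t₁} (at E k′) (s₂≢Y Yk′≡t₂) s₃≢k′ (sym Yk′≡t₂))

  ¬YFibreRepeated : ∀ {x s₂ t₂ s₃ t₃} → (x , s₂ , s₃) ≈ (x , t₂ , t₃) → s₂ ≢ t₂ →
                    ¬ YFibreRepeated s₂
  ¬YFibreRepeated {x} {s₂} {t₂} {s₃} {t₃} E s₂≢t₂ (k₁ , k₂ , Yk₁≡s₂ , Yk₂≡s₂ , k₁≢k₂) =
    k₁≢k₂ (inject₁-injective (trans (sym (t₃≡k Yk₁≡s₂)) (t₃≡k Yk₂≡s₂)))
    where
    t₃≡k : ∀ {k} → Y k ≡ s₂ → t₃ ≡ inject₁ k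
    t₃≡k {k} Yk≡s₂ = s₂≡q₂∧t₂≢q₂⇒t₃≡q₃ (at E k) (sym Yk≡s₂) (s₂≢t₂ ∘ trans (sym Yk≡s₂) ∘ sym)

  third-coordinates-agree : ∀ {x y s₃ t₃} → (x , y , s₃) ≈ (x , y , t₃) → s₃ ≡ t₃
  third-coordinates-agree {x} {y} {s₃} {t₃} E = decidable-stable (s₃ ≟ t₃) λ s₃≢t₃ →
    s₃≢t₃ ([ (λ det → det E) , (λ det → sym (det (≈-sym E))) ]
           (one-of-distinct {P = Determined} determined s₃≢t₃))
    where
    Determined : Fin (suc n) → Set
    Determined z = ∀ {z′} → (x , y , z) ≈ (x , y , z′) → z ≡ z′

    determined : ∀ k → Determined (inject₁ k)
    determined k E′ = sym (s₃≡q₃⇒t₃≡q₃ {x = x} refl (at E′ k) refl)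

  module _ (design : IsResolving) where
    open IsResolving design

    first-coordinates-agree : ∀ {s₁ t₁ s₂ t₂ s₃ t₃} → (s₁ , s₂ , s₃) ≈ (t₁ , t₂ , t₃) → s₁ ≡ t₁
    first-coordinates-agree {s₁} {t₁} E = decidable-stable (s₁ ≟ t₁) λ s₁≢t₁ →
      let 2≤a = ≢⇒2≤ s₁≢t₁
          (k , Xk≡s₁ , t₃≡k) , s₂≢t₂ = third-in-XFibre E s₁≢t₁ (xFibreSplit 2≤a s₁)
          (k′ , Xk′≡t₁ , s₃≡k′) , _  = third-in-XFibre (≈-sym E) (s₁≢t₁ ∘ sym) (xFibreSplit 2≤a t₁)
      in [ ¬YFibreSplit (≈-sym E) (s₂≢t₂ ∘ sym) Xk≡s₁ t₃≡k , ¬YFibreSplit E s₂≢t₂ Xk′≡t₁ s₃≡k′ ]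
           (yFibreSplit 2≤a s₂≢t₂)

    second-coordinates-agree : ∀ {x s₂ t₂ s₃ t₃} → (x , s₂ , s₃) ≈ (x , t₂ , t₃) → s₂ ≡ t₂
    second-coordinates-agree {s₂ = s₂} {t₂} E = decidable-stable (s₂ ≟ t₂) λ s₂≢t₂ →
      [ ¬YFibreRepeated E s₂≢t₂ , ¬YFibreRepeated (≈-sym E) (s₂≢t₂ ∘ sym) ] (yFibreRepeated s₂≢t₂)

    ≈⇒≡ : ∀ {s t} → s ≈ t → s ≡ t
    ≈⇒≡ {s₁ , s₂ , s₃} {t₁ , t₂ , t₃} E with first-coordinates-agree E
    ... | refl with second-coordinates-agree E
    ... | refl = cong (λ z → s₁ , s₂ , z) (third-coordinates-agree E)

    resolving : Resolving points
    resolving s t s≢t =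
      let k , g≢ = ¬∀⟶∃¬ n _ (λ k → g s (point k) ℕ.≟ g t (point k)) (s≢t ∘ ≈⇒≡ ∘ agree)
      in point k , ∈-tabulate⁺ k , g≢

-- The second coordinate ranges over Fin (suc b), so that all its values but the last are inject₁ k.
module ModularDesign (a b n : ℕ) .{{_ : NonZero a}}
                     (a≤1+b : a ≤ suc b) (2a≤n : a + a ≤ n) (2b≤n : b + b ≤ n) where

  X : Fin n → Fin a
  X k = toℕ k mod a

  Y : Fin n → Fin (suc b)
  Y k = ⌊ toℕ k /2⌋ mod suc b

  open Design X Y

  private
    toℕ-X : ∀ {m} (m<n : m < n) → toℕ (X (fromℕ< m<n)) ≡ m % a
    toℕ-X m<n = trans (toℕ-fromℕ< _) (cong (_% a) (toℕ-fromℕ< m<n))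

    toℕ-Y : ∀ {m} (m<n : m < n) → ⌊ m /2⌋ < suc b → toℕ (Y (fromℕ< m<n)) ≡ ⌊ m /2⌋
    toℕ-Y m<n m/2<1+b =
      trans (toℕ-fromℕ< _) (trans (cong (λ m → ⌊ m /2⌋ % suc b) (toℕ-fromℕ< m<n)) (m<n⇒m%n≡m m/2<1+b))

  xFibreSplit : 2 ≤ a → ∀ x → XFibreSplit x
  xFibreSplit 2≤a x = fromℕ< t<n , fromℕ< t+a<n , X≡x t<n (m<n⇒m%n≡m t<a) ,
                      X≡x t+a<n (trans ([m+n]%n≡m%n t a) (m<n⇒m%n≡m t<a)) , Y≢Y
    where
    t : ℕ
    t = toℕ x

    t<a : t < a
    t<a = toℕ<n x

    t+a<a+a : t + a < a + a
    t+a<a+a = +-monoˡ-< a t<a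

    t+a<n : t + a < n
    t+a<n = <-≤-trans t+a<a+a 2a≤n

    t<n : t < n
    t<n = ≤-<-trans (m≤m+n t a) t+a<n

    X≡x : ∀ {m} (m<n : m < n) → m % a ≡ t → X (fromℕ< m<n) ≡ x
    X≡x m<n m%a≡t = toℕ-injective (trans (toℕ-X m<n) m%a≡t)

    Y≢Y : Y (fromℕ< t<n) ≢ Y (fromℕ< t+a<n)
    Y≢Y eq = <-irrefl (trans (sym (toℕ-Y t<n t/2<1+b)) (trans (cong toℕ eq) (toℕ-Y t+a<n [t+a]/2<1+b)))
                      (⌊m/2⌋<⌊m+n/2⌋ t 2≤a)
      where
      t/2<1+b : ⌊ t /2⌋ < suc b
      t/2<1+b = ≤-<-trans (⌊n/2⌋≤n t) (<-≤-trans t<a a≤1+b)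

      [t+a]/2<1+b : ⌊ t + a /2⌋ < suc b
      [t+a]/2<1+b = ⌊m/2⌋<n (<-≤-trans t+a<a+a (+-mono-≤ a≤1+b a≤1+b))

  module _ (k : Fin b) where
    private
      t : ℕ
      t = toℕ k

      1+2t<n : suc (t + t) < n
      1+2t<n = <-≤-trans (≤-reflexive (cong suc (sym (+-suc t t))))
                         (≤-trans (+-mono-≤ (toℕ<n k) (toℕ<n k)) 2b≤n)

      2t<n : t + t < n
      2t<n = <-trans (n<1+n (t + t)) 1+2t<n

      k₀ k₁ : Fin n
      k₀ = fromℕ< 2t<n
      k₁ = fromℕ< 1+2t<n

      Y≡k : ∀ {m} (m<n : m < n) → ⌊ m /2⌋ ≡ t → Y (fromℕ< m<n) ≡ inject₁ k
      Y≡k m<n m/2≡t = toℕ-injective (begin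
        toℕ (Y (fromℕ< m<n)) ≡⟨ toℕ-Y m<n (subst (_< suc b) (sym m/2≡t) (m<n⇒m<1+n (toℕ<n k))) ⟩
        ⌊ _ /2⌋              ≡⟨ m/2≡t ⟩
        t                    ≡⟨ toℕ-inject₁ k ⟨
        toℕ (inject₁ k)      ∎)
        where open ≡-Reasoning

      Yk₀≡k : Y k₀ ≡ inject₁ k
      Yk₀≡k = Y≡k 2t<n (sym (n≡⌊n+n/2⌋ t))

      Yk₁≡k : Y k₁ ≡ inject₁ k
      Yk₁≡k = Y≡k 1+2t<n (sym (n≡⌈n+n/2⌉ t))

    inject₁-YFibreRepeated : YFibreRepeated (inject₁ k)
    inject₁-YFibreRepeated = k₀ , k₁ , Yk₀≡k , Yk₁≡k , λ k₀≡k₁ →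
      1+n≢n (trans (sym (toℕ-fromℕ< 1+2t<n)) (trans (cong toℕ (sym k₀≡k₁)) (toℕ-fromℕ< 2t<n)))

    inject₁-YFibreSplit : 2 ≤ a → YFibreSplit (inject₁ k)
    inject₁-YFibreSplit 2≤a = k₀ , k₁ , Yk₀≡k , Yk₁≡k , λ Xk₀≡Xk₁ →
      suc[m]%d≢m%d (t + t) 2≤a (trans (sym (toℕ-X 1+2t<n)) (trans (cong toℕ (sym Xk₀≡Xk₁)) (toℕ-X 2t<n)))

  isResolving : IsResolving
  isResolving = record
    { xFibreSplit    = xFibreSplit
    ; yFibreSplit    = λ 2≤a → one-of-distinct (λ k → inject₁-YFibreSplit k 2≤a)
    ; yFibreRepeated = one-of-distinct inject₁-YFibreRepeated
    }

theorem6 : (a b c : ℕ) → 1 ≤ a → a ≤ b → b ≤ c → 3 * a < b + c → 2 * b ≤ c →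
    IsMetricDim a b c (c ∸ 1)
theorem6 zero    _       _       ()  _   _  _       _
theorem6 (suc _) zero    _       _   ()  _  _       _
theorem6 (suc _) (suc _) zero    _   _   () _       _
theorem6 (suc a) (suc b) (suc n) _   a≤b _  3a<b+c 2b≤c =
  (points , points-unique , resolving isResolving , length-points) ,
  λ Q _ → LowerBound.c∸1≤length Q Fin.zero Fin.zero
  where
  2a≤n : suc a + suc a ≤ n
  2a≤n = subst (_≤ n) (2*m≡m+m (suc a)) (s≤s⁻¹ (2*a<c (suc a) (suc b) 3a<b+c 2b≤c))

  2b≤n : b + b ≤ n
  2b≤n = subst (_≤ n) (2*m≡m+m b) (s≤s⁻¹ (<-≤-trans (*-monoʳ-< 2 (n<1+n b)) 2b≤c))

  open ModularDesign (suc a) b n a≤b 2a≤n 2b≤n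
  open Design X Y
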